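{- Let $G$ be a finite group, $H$ a subgroup, and $S\subseteq G\setminus H$ a set of representatives of pairwise distinct double cosets $HsH$ with $\langle H,S\rangle=G$. Suppose the Cayley coset digraph $\mathcal{G}=\mathcal{G}(G,H,S)$, with $n$ vertices and vertex connectivity $\kappa$, is not complete and has an atom of size at most $(n-\kappa)/2$. Let $A_0$ be the atom containing the vertex $H$ and let $S_0=\{s\in S: s\in\bigcup A_0\}$. Then the subset $\bigcup A_0$ of $G$ (the union of the cosets in $A_0$) equals the subgroup $\langle H,S_0\rangle$, and the edges of $\mathcal{G}$ with both endpoints in $A_0$ are exactly $\big(\bigcup_{s\in S_0}E_s\big)\cap(A_0\times A_0)$.
   Context: The Cayley coset digraph $\mathcal{G}(G,H,S)$ has vertex set $G/H$ of left cosets of $H$, and $(gH,g'H)$ is an edge iff $gHs\cap g'H\neq\emptyset$ for some $s\in S$. For $s\in S$, $E_s=\{(g_1H,g_2H): g_1Hs\cap g_2H\neq\emptyset\}$ is the set of edges induced by $s$. For $A\subseteq V$, $N(A)$ is the set of vertices outside $A$ that are heads of edges with tail in $A$; $A$ is a part if $V\setminus(A\cup N(A))\neq\emptyset$. The vertex connectivity $\kappa$ is the smallest number of vertices whose removal leaves a digraph that is not strongly connected. An atom is a part $A$ with $|N(A)|=\kappa$ of minimum size among such parts. Under the hypotheses the atoms partition the vertex set, so the atom containing $H$ is unique. A digraph is complete if every ordered pair of distinct vertices is an edge. -}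

module Defs where

open import Data.Nat using (ℕ; _≤_)
open import Data.Fin using (Fin)
open import Data.Fin.Subset using (Subset; _∈_; _∉_; _⊆_; ∣_∣)
open import Data.Product using (Σ; ∃; _×_; _,_)
open import Data.Sum using (_⊎_)
open import Relation.Nullary using (¬_)
open import Relation.Binary.PropositionalEquality using (_≡_; _≢_)
open import Algebra.Core using (Op₁; Op₂)
open import Algebra.Structures using (IsGroup)

-- Finite groups: a group structure on Fin N (every finite group is
-- isomorphic to one of this form), with propositional equality.

record FiniteGroup : Set where
  field
    N       : ℕ
    _∙_     : Op₂ (Fin N)
    ε       : Fin N
    _⁻¹     : Op₁ (Fin N)
    isGroup : IsGroup _≡_ _∙_ ε _⁻¹
  infixl 7 _∙_
  infix 8 _⁻¹

-- General digraph notions.  The vertex set is V ⊆ Fin N, the edge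
-- relation is E (only its restriction to V matters).

module Digraph {N : ℕ} (V : Subset N) (E : Fin N → Fin N → Set) where

  order : ℕ
  order = ∣ V ∣

  IsComplete : Set
  IsComplete = ∀ u v → u ∈ V → v ∈ V → u ≢ v → E u v

  InNbhd : Subset N → Fin N → Set
  InNbhd A v = v ∈ V × v ∉ A × (∃ λ a → a ∈ A × E a v)

  NbhdSize : Subset N → ℕ → Set
  NbhdSize A k = Σ (Subset N) λ B →
    (∀ v → v ∈ B → InNbhd A v) × (∀ v → InNbhd A v → v ∈ B) × ∣ B ∣ ≡ k

  IsPart : Subset N → Set
  IsPart A = A ⊆ V × (∃ λ v → v ∈ V × v ∉ A × ¬ InNbhd A v)

  data Reach (W : Fin N → Set) : Fin N → Fin N → Set where
    here : ∀ {u} → Reach W u u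
    step : ∀ {u w v} → E u w → W w → Reach W w v → Reach W u v

  StronglyConnected : (Fin N → Set) → Set
  StronglyConnected W = ∀ u v → W u → W v → Reach W u v

  Remaining : Subset N → Fin N → Set
  Remaining X u = u ∈ V × u ∉ X

  IsConnectivity : ℕ → Set
  IsConnectivity κ =
    (Σ (Subset N) λ X → X ⊆ V × ∣ X ∣ ≡ κ × ¬ StronglyConnected (Remaining X))
    × (∀ X → X ⊆ V → ¬ StronglyConnected (Remaining X) → κ ≤ ∣ X ∣)

  IsAtom : ℕ → Subset N → Set
  IsAtom κ A = IsPart A × NbhdSize A κ
    × (∀ B → IsPart B → NbhdSize B κ → ∣ A ∣ ≤ ∣ B ∣)

module CosetDigraph (G : FiniteGroup) where
  open FiniteGroup G

  IsSubgroup : Subset N → Set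
  IsSubgroup H = ε ∈ H × (∀ x y → x ∈ H → y ∈ H → x ∙ y ∈ H)
                 × (∀ x → x ∈ H → x ⁻¹ ∈ H)

  data Gen (P : Fin N → Set) : Fin N → Set where
    gen : ∀ {x} → P x → Gen P x
    one : Gen P ε
    mul : ∀ {x y} → Gen P x → Gen P y → Gen P (x ∙ y)
    inv : ∀ {x} → Gen P x → Gen P (x ⁻¹)

  module _ (H : Subset N) where

    InCoset : Fin N → Fin N → Set
    InCoset x y = ∃ λ h → h ∈ H × y ≡ x ∙ h

    InDoubleCoset : Fin N → Fin N → Set
    InDoubleCoset x y = ∃ λ h → ∃ λ k → h ∈ H × k ∈ H × y ≡ h ∙ x ∙ k

    -- T is a set of representatives of the left cosets of H: the vertex
    -- xH of G/H is represented by the unique t ∈ T with t ∈ xH.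
    IsTransversal : Subset N → Set
    IsTransversal T = (∀ g → ∃ λ t → t ∈ T × InCoset t g)
                      × (∀ t t' → t ∈ T → t' ∈ T → InCoset t t' → t ≡ t')

    -- (xH, yH) ∈ E_s  iff  xHs ∩ yH ≠ ∅
    EdgeBy : Fin N → Fin N → Fin N → Set
    EdgeBy s x y = ∃ λ h → ∃ λ k → h ∈ H × k ∈ H × x ∙ h ∙ s ≡ y ∙ k

    Edge : Subset N → Fin N → Fin N → Set
    Edge S x y = ∃ λ s → s ∈ S × EdgeBy s x y

    Union : Subset N → Fin N → Set
    Union A g = ∃ λ a → a ∈ A × InCoset a g

-- Left multiplication by g ∈ G permutes the cosets and preserves edges, so it maps atoms to
-- atoms.  Under the bound 2|A| ≤ n − κ two atoms A, B that meet satisfy A ⊆ B: if their exteriors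
-- V ∖ (A ∪ N(A)) and V ∖ (B ∪ N(B)) meet, submodularity of |N| makes A ∩ B a part with |N(A ∩ B)| = κ,
-- so A ⊆ A ∩ B by minimality; otherwise counting vertices contradicts the bound.  Hence for g ∈ ⋃A₀
-- the translate gA₀, which contains the vertex H, is A₀ itself: ⋃A₀ is a subgroup containing H and
-- the label of every edge inside A₀.  Conversely the vertices reachable from H inside A₀ form a part
-- whose neighbourhood lies in N(A₀), hence are all of A₀, and a walk from H only multiplies by
-- elements of H and S₀.

module Submission where

open import Defs
open import Level using (0ℓ)
open import Data.Nat using (ℕ; zero; suc; _+_; _*_; _∸_; _≤_; z≤n; s≤s)
open import Data.Nat.Properties
  using (≤-trans; ≤-reflexive; ≤-antisym; <-irrefl; <⇒≱; +-suc; +-identityʳ; +-mono-≤; +-monoˡ-≤; +-monoʳ-≤;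
         +-monoʳ-<; +-cancelˡ-≤; +-cancelʳ-≤; ∸-monoˡ-≤; m+n∸n≡m; m≤m+n; module ≤-Reasoning)
open import Data.Fin using (Fin; zero; suc; _≟_)
open import Data.Fin.Properties using (any?)
open import Data.Fin.Subset
  using (Subset; inside; outside; _∈_; _∉_; _⊆_; _⊂_; _⊃_; _∪_; _∩_; _─_; _-_; ⁅_⁆; ∣_∣; Nonempty; Empty)
open import Data.Fin.Subset.Properties
  using (_∈?_; p⊆q⇒∣p∣≤∣q∣; p⊂q⇒∣p∣<∣q∣; x∈p∪q⁺; x∈p∪q⁻; x∈p∩q⁺; x∈p∩q⁻; p∩q⊆p; p∩q⊆q; ⊆-antisym; ∣⊥∣≡0;
         x∈⁅x⁆; x∈⁅y⁆⇒x≡y; ∣⁅x⁆∣≡1; Empty-unique; nonempty?; p─q⊆p; x∈p∧x≢y⇒x∈p-y; x∈p∧x∉q⇒x∈p─q; x∈p⇒p-x⊂p; x∈p⇒∣p-x∣<∣p∣; p∩q≢∅⇒∣p─q∣<∣p∣)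
open import Data.Fin.Subset.Induction using (⊂-wellFounded; ⊃-wellFounded)
open import Induction.WellFounded using (Acc; acc)
open import Data.Vec using (_∷_; [])
open import Data.Product using (∃; _×_; _,_; proj₁; proj₂; uncurry)
open import Data.Sum using (_⊎_; inj₁; inj₂; [_,_])
import Data.Sum
import Data.Product
open import Data.Bool using (if_then_else_)
open import Function using (_∘_; id)
open import Data.Empty using (⊥-elim)
open import Algebra.Bundles using (Group)
open import Algebra.Structures using (IsGroup)
open import Relation.Unary using (Pred; Decidable)
open import Relation.Nullary using (¬_; Dec; yes; no; does; ¬?; contradiction)
open import Relation.Nullary.Decidable using (_×-dec_)
open import Relation.Binary.PropositionalEquality using (_≡_; refl; sym; trans; cong; cong₂; subst; module ≡-Reasoning)

module FiniteSubsets where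

  open import Data.Vec using (here; there)

  private variable
    m n : ℕ
    p q r s : Subset n

  select : {P : Pred (Fin n) 0ℓ} → Decidable P → Subset n
  select {zero}  P? = []
  select {suc n} P? = (if does (P? zero) then inside else outside) ∷ select (P? ∘ suc)

  ∈-select⁺ : {P : Pred (Fin n) 0ℓ} (P? : Decidable P) {x : Fin n} → P x → x ∈ select P?
  ∈-select⁺ P? {zero} px with P? zero
  ... | yes _  = here
  ... | no ¬px = contradiction px ¬px
  ∈-select⁺ P? {suc x} px = there (∈-select⁺ (P? ∘ suc) px)

  ∈-select⁻ : {P : Pred (Fin n) 0ℓ} (P? : Decidable P) {x : Fin n} → x ∈ select P? → P x
  ∈-select⁻ P? {zero} x∈ with P? zero | x∈
  ... | yes px | _ = px
  ∈-select⁻ P? {suc x} (there x∈) = ∈-select⁻ (P? ∘ suc) x∈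

  ∣p∪q∣+∣p∩q∣≡∣p∣+∣q∣ : (p q : Subset n) → ∣ p ∪ q ∣ + ∣ p ∩ q ∣ ≡ ∣ p ∣ + ∣ q ∣
  ∣p∪q∣+∣p∩q∣≡∣p∣+∣q∣ []            []            = refl
  ∣p∪q∣+∣p∩q∣≡∣p∣+∣q∣ (inside ∷ p)  (inside ∷ q)  =
    cong suc (trans (+-suc _ _) (trans (cong suc (∣p∪q∣+∣p∩q∣≡∣p∣+∣q∣ p q)) (sym (+-suc _ _))))
  ∣p∪q∣+∣p∩q∣≡∣p∣+∣q∣ (inside ∷ p)  (outside ∷ q) = cong suc (∣p∪q∣+∣p∩q∣≡∣p∣+∣q∣ p q)
  ∣p∪q∣+∣p∩q∣≡∣p∣+∣q∣ (outside ∷ p) (inside ∷ q)  =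
    trans (cong suc (∣p∪q∣+∣p∩q∣≡∣p∣+∣q∣ p q)) (sym (+-suc _ _))
  ∣p∪q∣+∣p∩q∣≡∣p∣+∣q∣ (outside ∷ p) (outside ∷ q) = ∣p∪q∣+∣p∩q∣≡∣p∣+∣q∣ p q

  -- The hypotheses say that every element lies in at least as many of r, s as of p, q.
  ∣p∣+∣q∣≤∣r∣+∣s∣ : (p q r s : Subset n)
    → (∀ {x} → x ∈ p ⊎ x ∈ q → x ∈ r ⊎ x ∈ s)
    → (∀ {x} → x ∈ p → x ∈ q → x ∈ r × x ∈ s)
    → ∣ p ∣ + ∣ q ∣ ≤ ∣ r ∣ + ∣ s ∣
  ∣p∣+∣q∣≤∣r∣+∣s∣ p q r s ∪⊆ ∩⊆ = begin
    ∣ p ∣ + ∣ q ∣             ≡⟨ sym (∣p∪q∣+∣p∩q∣≡∣p∣+∣q∣ p q) ⟩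
    ∣ p ∪ q ∣ + ∣ p ∩ q ∣     ≤⟨ +-mono-≤ (p⊆q⇒∣p∣≤∣q∣ (x∈p∪q⁺ ∘ ∪⊆ ∘ x∈p∪q⁻ p q))
                                          (p⊆q⇒∣p∣≤∣q∣ (x∈p∩q⁺ ∘ uncurry ∩⊆ ∘ x∈p∩q⁻ p q)) ⟩
    ∣ r ∪ s ∣ + ∣ r ∩ s ∣     ≡⟨ ∣p∪q∣+∣p∩q∣≡∣p∣+∣q∣ r s ⟩
    ∣ r ∣ + ∣ s ∣             ∎
    where open ≤-Reasoning

  ∣p∣≤∣q∣+∣r∣ : (p q r : Subset n) → (∀ {x} → x ∈ p → x ∈ q ⊎ x ∈ r) → ∣ p ∣ ≤ ∣ q ∣ + ∣ r ∣
  ∣p∣≤∣q∣+∣r∣ p q r cover = begin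
    ∣ p ∣                   ≤⟨ p⊆q⇒∣p∣≤∣q∣ (x∈p∪q⁺ ∘ cover) ⟩
    ∣ q ∪ r ∣               ≤⟨ m≤m+n ∣ q ∪ r ∣ ∣ q ∩ r ∣ ⟩
    ∣ q ∪ r ∣ + ∣ q ∩ r ∣   ≡⟨ ∣p∪q∣+∣p∩q∣≡∣p∣+∣q∣ q r ⟩
    ∣ q ∣ + ∣ r ∣           ∎
    where open ≤-Reasoning

  p⊆q∧∣q∣≤∣p∣⇒q⊆p : p ⊆ q → ∣ q ∣ ≤ ∣ p ∣ → q ⊆ p
  p⊆q∧∣q∣≤∣p∣⇒q⊆p {p = p} p⊆q ∣q∣≤∣p∣ {x} x∈q with x ∈? p
  ... | yes x∈p = x∈p
  ... | no  x∉p = contradiction ∣q∣≤∣p∣ (<⇒≱ (p⊂q⇒∣p∣<∣q∣ (p⊆q , x , x∈q , x∉p)))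

  x∉p-x : (p : Subset n) (x : Fin n) → x ∉ p - x
  x∉p-x (_ ∷ p) zero    ()
  x∉p-x (_ ∷ p) (suc x) (there x∈) = x∉p-x p x x∈

  ∣p∣≤1+∣p-x∣ : (p : Subset n) (x : Fin n) → ∣ p ∣ ≤ 1 + ∣ p - x ∣
  ∣p∣≤1+∣p-x∣ p x = ≤-trans (∣p∣≤∣q∣+∣r∣ p ⁅ x ⁆ (p - x) split) (≤-reflexive (cong (_+ ∣ p - x ∣) (∣⁅x⁆∣≡1 x)))
    where
    split : ∀ {y} → y ∈ p → y ∈ ⁅ x ⁆ ⊎ y ∈ p - x
    split {y} y∈p with y ≟ x
    ... | yes refl = inj₁ (x∈⁅x⁆ x)
    ... | no  y≢x  = inj₂ (x∈p∧x≢y⇒x∈p-y y∈p y≢x)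

  injectiveOn⇒∣p∣≤∣q∣ : (f : Fin m → Fin n) (p : Subset m) (q : Subset n)
    → (∀ {x} → x ∈ p → f x ∈ q)
    → (∀ {x y} → x ∈ p → y ∈ p → f x ≡ f y → x ≡ y)
    → ∣ p ∣ ≤ ∣ q ∣
  injectiveOn⇒∣p∣≤∣q∣ {m} {n} f p q = go p (⊂-wellFounded p) q
    where
    go : ∀ p → Acc _⊂_ p → ∀ (q : Subset n) → (∀ {x} → x ∈ p → f x ∈ q) → (∀ {x y} → x ∈ p → y ∈ p → f x ≡ f y → x ≡ y)
       → ∣ p ∣ ≤ ∣ q ∣
    go p (acc rec) q into inj with nonempty? p
    ... | no  p-empty = ≤-trans (≤-reflexive (trans (cong ∣_∣ (Empty-unique p-empty)) (∣⊥∣≡0 m))) z≤n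
    ... | yes (x , x∈p) = begin
      ∣ p ∣                ≤⟨ ∣p∣≤1+∣p-x∣ p x ⟩
      1 + ∣ p - x ∣        ≤⟨ s≤s (go (p - x) (rec (x∈p⇒p-x⊂p x∈p)) (q - f x) into' inj') ⟩
      1 + ∣ q - f x ∣      ≤⟨ x∈p⇒∣p-x∣<∣p∣ {p = q} (into x∈p) ⟩
      ∣ q ∣                ∎
      where
      open ≤-Reasoning
      into' : ∀ {y} → y ∈ p - x → f y ∈ q - f x
      into' {y} y∈ = x∈p∧x≢y⇒x∈p-y (into (p─q⊆p p _ y∈))
                       (λ fy≡fx → x∉p-x p x (subst (_∈ p - x) (inj (p─q⊆p p _ y∈) x∈p fy≡fx) y∈))
      inj' : ∀ {y z} → y ∈ p - x → z ∈ p - x → f y ≡ f z → y ≡ z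
      inj' y∈ z∈ = inj (p─q⊆p p _ y∈) (p─q⊆p p _ z∈)

  inflationary⇒postfixedPoint : (F : Subset n → Subset n) → (∀ p → p ⊆ F p)
    → (I : Pred (Subset n) 0ℓ) → (∀ {p} → I p → I (F p))
    → ∀ p → I p → ∃ λ q → I q × p ⊆ q × F q ⊆ q
  inflationary⇒postfixedPoint F inflationary I preserved p = go p (⊃-wellFounded p)
    where
    go : ∀ p → Acc _⊃_ p → I p → ∃ λ q → I q × p ⊆ q × F q ⊆ q
    go p (acc rec) Ip with any? (λ x → (x ∈? F p) ×-dec ¬? (x ∈? p))
    ... | yes (x , x∈Fp , x∉p) =
      let q , Iq , Fp⊆q , Fq⊆q = go (F p) (rec (inflationary p , x , x∈Fp , x∉p)) (preserved Ip)
      in  q , Iq , Fp⊆q ∘ inflationary p , Fq⊆q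
    ... | no  ∄new = p , Ip , id , Fp⊆p
      where
      Fp⊆p : F p ⊆ p
      Fp⊆p {x} x∈Fp with x ∈? p
      ... | yes x∈p = x∈p
      ... | no  x∉p = contradiction (x , x∈Fp , x∉p) ∄new

module Atoms {n : ℕ} (V : Subset n) (E : Fin n → Fin n → Set) (E? : ∀ u v → Dec (E u v)) where

  open Digraph V E
  open FiniteSubsets

  private variable
    A B X : Subset n
    a u v w : Fin n
    k : ℕ

  InNbhd? : ∀ A → Decidable (InNbhd A)
  InNbhd? A v = (v ∈? V) ×-dec ¬? (v ∈? A) ×-dec any? (λ a → (a ∈? A) ×-dec E? a v)

  N⁺ : Subset n → Subset n
  N⁺ A = select (InNbhd? A)

  InNbhd⁻ : Subset n → Fin n → Set
  InNbhd⁻ A v = v ∈ V × v ∉ A × ∃ λ a → a ∈ A × E v a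

  InNbhd⁻? : ∀ A → Decidable (InNbhd⁻ A)
  InNbhd⁻? A v = (v ∈? V) ×-dec ¬? (v ∈? A) ×-dec any? (λ a → (a ∈? A) ×-dec E? v a)

  N⁻ : Subset n → Subset n
  N⁻ A = select (InNbhd⁻? A)

  IsExterior : Subset n → Fin n → Set
  IsExterior A v = v ∈ V × v ∉ A × ¬ InNbhd A v

  exterior : Subset n → Subset n
  exterior A = select (λ v → (v ∈? V) ×-dec ¬? (v ∈? A) ×-dec ¬? (InNbhd? A v))

  edge-from : a ∈ A → E a v → v ∈ V → v ∈ A ⊎ InNbhd A v
  edge-from {A = A} {v = v} a∈A e v∈V with v ∈? A
  ... | yes v∈A = inj₁ v∈A
  ... | no  v∉A = inj₂ (v∈V , v∉A , _ , a∈A , e)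

  edge-into-exterior : E v w → IsExterior A w → v ∉ A
  edge-into-exterior e (w∈V , w∉A , w∉N) v∈A = [ w∉A , w∉N ] (edge-from v∈A e w∈V)

  non-exterior : v ∈ V → ¬ IsExterior A v → v ∈ A ⊎ InNbhd A v
  non-exterior {v = v} {A = A} v∈V ¬ext with v ∈? A | InNbhd? A v
  ... | yes v∈A | _      = inj₁ v∈A
  ... | no  _   | yes vN = inj₂ vN
  ... | no  v∉A | no ¬vN = contradiction (v∈V , v∉A , ¬vN) ¬ext

  exterior-∩ʳ : IsExterior B w → IsExterior (A ∩ B) w
  exterior-∩ʳ {B = B} {A = A} (w∈V , w∉B , w∉N) =
    w∈V , w∉B ∘ proj₂ ∘ x∈p∩q⁻ A B ,
    λ (_ , _ , a , a∈A∩B , e) → w∉N (w∈V , w∉B , a , proj₂ (x∈p∩q⁻ A B a∈A∩B) , e)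

  NbhdSize⇒∣N⁺∣≡ : NbhdSize A k → ∣ N⁺ A ∣ ≡ k
  NbhdSize⇒∣N⁺∣≡ (B , B⊆N , N⊆B , ∣B∣≡k) =
    trans (≤-antisym (p⊆q⇒∣p∣≤∣q∣ (N⊆B _ ∘ ∈-select⁻ _)) (p⊆q⇒∣p∣≤∣q∣ (∈-select⁺ _ ∘ B⊆N _))) ∣B∣≡k

  ∣N⁺∣≡⇒NbhdSize : ∣ N⁺ A ∣ ≡ k → NbhdSize A k
  ∣N⁺∣≡⇒NbhdSize {A = A} eq = N⁺ A , (λ _ → ∈-select⁻ _) , (λ _ → ∈-select⁺ _) , eq

  reach-avoiding-N⁺ : Reach (Remaining (N⁺ A)) u v → u ∈ A → v ∈ A
  reach-avoiding-N⁺ here u∈A = u∈A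
  reach-avoiding-N⁺ {A = A} (step {w = w} e (w∈V , w∉N) walk) u∈A with w ∈? A
  ... | yes w∈A = reach-avoiding-N⁺ walk w∈A
  ... | no  w∉A = contradiction (∈-select⁺ _ (w∈V , w∉A , _ , u∈A , e)) w∉N

  reach-avoiding-N⁻ : Remaining (N⁻ A) u → Reach (Remaining (N⁻ A)) u v → v ∈ A → u ∈ A
  reach-avoiding-N⁻ _ here v∈A = v∈A
  reach-avoiding-N⁻ {A = A} {u = u} (u∈V , u∉N) (step e w-kept walk) v∈A with u ∈? A
  ... | yes u∈A = u∈A
  ... | no  u∉A = contradiction (∈-select⁺ _ (u∈V , u∉A , _ , reach-avoiding-N⁻ w-kept walk v∈A , e)) u∉N

  out-of-∩ : InNbhd (A ∩ B) v → (v ∈ A ⊎ InNbhd A v) × (v ∈ B ⊎ InNbhd B v)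
  out-of-∩ {A = A} {B = B} (v∈V , _ , a , a∈A∩B , e) =
    edge-from (proj₁ (x∈p∩q⁻ A B a∈A∩B)) e v∈V , edge-from (proj₂ (x∈p∩q⁻ A B a∈A∩B)) e v∈V

  into-exterior-∩ : InNbhd⁻ (exterior A ∩ exterior B) v → v ∉ A × v ∉ B
  into-exterior-∩ {A = A} {B = B} (_ , _ , q , q∈ , e) =
    edge-into-exterior e (∈-select⁻ _ (proj₁ (x∈p∩q⁻ (exterior A) (exterior B) q∈))) ,
    edge-into-exterior e (∈-select⁻ _ (proj₂ (x∈p∩q⁻ (exterior A) (exterior B) q∈)))

  ∣N⁺∣-submodular : ∀ A B → ∣ N⁺ (A ∩ B) ∣ + ∣ N⁻ (exterior A ∩ exterior B) ∣ ≤ ∣ N⁺ A ∣ + ∣ N⁺ B ∣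
  ∣N⁺∣-submodular A B = ∣p∣+∣q∣≤∣r∣+∣s∣ _ _ _ _
    (Data.Sum.map (∈-select⁺ _) (∈-select⁺ _) ∘ [ leaving , entering ])
    (λ v∈N⁺ v∈N⁻ → Data.Product.map (∈-select⁺ _) (∈-select⁺ _) (both (∈-select⁻ _ v∈N⁺) (∈-select⁻ _ v∈N⁻)))
    where
    resolve : v ∈ X ⊎ InNbhd X v → v ∉ X → InNbhd X v
    resolve (inj₁ v∈X) v∉X = contradiction v∈X v∉X
    resolve (inj₂ vN)  _   = vN

    leaving : v ∈ N⁺ (A ∩ B) → InNbhd A v ⊎ InNbhd B v
    leaving v∈N with ∈-select⁻ _ v∈N
    ... | vN@(_ , v∉A∩B , _) with out-of-∩ vN
    ...   | inj₁ v∈A , inj₁ v∈B = contradiction (x∈p∩q⁺ (v∈A , v∈B)) v∉A∩B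
    ...   | inj₁ _   , inj₂ vNB = inj₂ vNB
    ...   | inj₂ vNA , _        = inj₁ vNA

    entering : v ∈ N⁻ (exterior A ∩ exterior B) → InNbhd A v ⊎ InNbhd B v
    entering {v} v∈N with ∈-select⁻ _ v∈N
    ... | vN@(v∈V , v∉Q , _) with into-exterior-∩ vN | InNbhd? A v
    ...   | _         | yes vNA = inj₁ vNA
    ...   | v∉A , v∉B | no ¬vNA = inj₂ (resolve (non-exterior v∈V v∉extB) v∉B)
      where
      v∉extB : ¬ IsExterior B v
      v∉extB extB = v∉Q (x∈p∩q⁺ (∈-select⁺ _ (v∈V , v∉A , ¬vNA) , ∈-select⁺ _ extB))

    both : InNbhd (A ∩ B) v → InNbhd⁻ (exterior A ∩ exterior B) v → InNbhd A v × InNbhd B v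
    both vN vN⁻ with out-of-∩ vN | into-exterior-∩ vN⁻
    ... | from-A , from-B | v∉A , v∉B = resolve from-A v∉A , resolve from-B v∉B

  ∣N⁺[A∩B]∣+∣exterior[B]∣≤∣N⁺[A]∣+∣A─B∣ : ∀ A B → Empty (exterior A ∩ exterior B)
    → ∣ N⁺ (A ∩ B) ∣ + ∣ exterior B ∣ ≤ ∣ N⁺ A ∣ + ∣ A ─ B ∣
  ∣N⁺[A∩B]∣+∣exterior[B]∣≤∣N⁺[A]∣+∣A─B∣ A B disjoint = ∣p∣+∣q∣≤∣r∣+∣s∣ _ _ _ _
    [ leaving ∘ ∈-select⁻ _ , outside-B ∘ ∈-select⁻ _ ]
    (λ v∈N⁺ v∈ext → contradiction (proj₂ (out-of-∩ (∈-select⁻ _ v∈N⁺))) (∉B∪N⁺B (∈-select⁻ _ v∈ext)))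
    where
    into-A─B : v ∈ A ⊎ InNbhd A v → (v ∈ A → v ∉ B) → v ∈ N⁺ A ⊎ v ∈ A ─ B
    into-A─B (inj₁ v∈A) v∉B = inj₂ (x∈p∧x∉q⇒x∈p─q v∈A (v∉B v∈A))
    into-A─B (inj₂ vNA) _   = inj₁ (∈-select⁺ _ vNA)

    leaving : InNbhd (A ∩ B) v → v ∈ N⁺ A ⊎ v ∈ A ─ B
    leaving vN@(_ , v∉A∩B , _) = into-A─B (proj₁ (out-of-∩ vN)) (λ v∈A v∈B → v∉A∩B (x∈p∩q⁺ (v∈A , v∈B)))

    outside-B : IsExterior B v → v ∈ N⁺ A ⊎ v ∈ A ─ B
    outside-B {v} extB@(v∈V , v∉B , _) =
      into-A─B (non-exterior v∈V (λ extA → disjoint (v , x∈p∩q⁺ (∈-select⁺ _ extA , ∈-select⁺ _ extB)))) (λ _ → v∉B)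

    ∉B∪N⁺B : IsExterior B v → ¬ (v ∈ B ⊎ InNbhd B v)
    ∉B∪N⁺B (_ , v∉B , v∉N) = [ v∉B , v∉N ]

  order≤∣A∣+∣exterior∣+∣N⁺∣ : ∀ A → order ≤ ∣ A ∣ + ∣ exterior A ∣ + ∣ N⁺ A ∣
  order≤∣A∣+∣exterior∣+∣N⁺∣ A = ≤-trans (∣p∣≤∣q∣+∣r∣ V (A ∪ exterior A) (N⁺ A) cover)
    (+-monoˡ-≤ ∣ N⁺ A ∣ (∣p∣≤∣q∣+∣r∣ (A ∪ exterior A) A (exterior A) (x∈p∪q⁻ A (exterior A))))
    where
    cover : v ∈ V → v ∈ A ∪ exterior A ⊎ v ∈ N⁺ A
    cover {v} v∈V with v ∈? A | InNbhd? A v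
    ... | yes v∈A | _      = inj₁ (x∈p∪q⁺ (inj₁ v∈A))
    ... | no  _   | yes vN = inj₂ (∈-select⁺ _ vN)
    ... | no  v∉A | no ¬vN = inj₁ (x∈p∪q⁺ (inj₂ (∈-select⁺ _ (v∈V , v∉A , ¬vN))))

  reach-snoc : {W : Fin n → Set} → Reach W u v → E v w → W w → Reach W u w
  reach-snoc here            e w∈W = step e w∈W here
  reach-snoc (step e′ x∈W r) e w∈W = step e′ x∈W (reach-snoc r e w∈W)

  reachable-within : ∀ W → a ∈ W → ∃ λ R → a ∈ R
    × (∀ {u v} → u ∈ R → E u v → v ∈ W → v ∈ R)
    × (∀ {v} → v ∈ R → v ∈ W × Reach (_∈ W) a v)
  reachable-within {a = a} W a∈W =
    let R , reached , a∈R , FR⊆R = inflationary⇒postfixedPoint F (λ _ → x∈p∪q⁺ ∘ inj₁) Reached preserved ⁅ a ⁆ start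
    in  R , a∈R (x∈⁅x⁆ a) , (λ u∈R e v∈W → FR⊆R (x∈p∪q⁺ (inj₂ (∈-select⁺ _ (v∈W , _ , u∈R , e))))) , reached
    where
    F : Subset n → Subset n
    F X = X ∪ select (λ v → (v ∈? W) ×-dec any? (λ u → (u ∈? X) ×-dec E? u v))

    Reached : Pred (Subset n) 0ℓ
    Reached X = ∀ {v} → v ∈ X → v ∈ W × Reach (_∈ W) a v

    start : Reached ⁅ a ⁆
    start v∈⁅a⁆ with x∈⁅y⁆⇒x≡y a v∈⁅a⁆
    ... | refl = a∈W , here

    preserved : ∀ {X} → Reached X → Reached (F X)
    preserved {X} reached v∈FX with x∈p∪q⁻ X _ v∈FX
    ... | inj₁ v∈X = reached v∈X
    ... | inj₂ new with ∈-select⁻ _ new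
    ...   | v∈W , _ , u∈X , e = v∈W , reach-snoc (proj₂ (reached u∈X)) e v∈W

  atoms-same-size : IsAtom k A → IsAtom k B → ∣ A ∣ ≡ ∣ B ∣
  atoms-same-size (partA , sizeA , minA) (partB , sizeB , minB) = ≤-antisym (minA _ partB sizeB) (minB _ partA sizeA)

  small-atom≤exterior : IsAtom k A → IsAtom k B → 2 * ∣ A ∣ ≤ order ∸ k → ∣ A ∣ ≤ ∣ exterior B ∣
  small-atom≤exterior {k = k} {A = A} {B = B} atomA atomB@(_ , sizeB , _) small = +-cancelˡ-≤ ∣ A ∣ _ _ (begin
    ∣ A ∣ + ∣ A ∣                              ≡⟨ cong (∣ A ∣ +_) (sym (+-identityʳ ∣ A ∣)) ⟩
    2 * ∣ A ∣                                  ≤⟨ small ⟩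
    order ∸ k                                  ≤⟨ ∸-monoˡ-≤ k (order≤∣A∣+∣exterior∣+∣N⁺∣ B) ⟩
    ∣ B ∣ + ∣ exterior B ∣ + ∣ N⁺ B ∣ ∸ k      ≡⟨ cong (λ m → ∣ B ∣ + ∣ exterior B ∣ + m ∸ k) (NbhdSize⇒∣N⁺∣≡ sizeB) ⟩
    ∣ B ∣ + ∣ exterior B ∣ + k ∸ k             ≡⟨ m+n∸n≡m _ k ⟩
    ∣ B ∣ + ∣ exterior B ∣                     ≡⟨ cong (_+ ∣ exterior B ∣) (sym (atoms-same-size atomA atomB)) ⟩
    ∣ A ∣ + ∣ exterior B ∣                     ∎)
    where open ≤-Reasoning

  record Automorphism : Set where
    field
      to from   : Fin n → Fin n
      to-∈V     : ∀ {v} → v ∈ V → to v ∈ V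
      from-∈V   : ∀ {v} → v ∈ V → from v ∈ V
      from-to   : ∀ {v} → v ∈ V → from (to v) ≡ v
      to-from   : ∀ {v} → v ∈ V → to (from v) ≡ v
      to-edge   : ∀ {u v} → E u v → E (to u) (to v)
      from-edge : ∀ {u v} → E u v → E (from u) (from v)

  inverse : Automorphism → Automorphism
  inverse σ = record
    { to = from ; from = to ; to-∈V = from-∈V ; from-∈V = to-∈V ; from-to = to-from ; to-from = from-to
    ; to-edge = from-edge ; from-edge = to-edge }
    where open Automorphism σ

  preimage : Automorphism → Subset n → Subset n
  preimage σ X = select (λ v → (v ∈? V) ×-dec (Automorphism.to σ v ∈? X))

  module _ (σ : Automorphism) where
    open Automorphism σ

    from-∈ : X ⊆ V → a ∈ X → from a ∈ preimage σ X
    from-∈ {X = X} X⊆V a∈X = ∈-select⁺ _ (from-∈V (X⊆V a∈X) , subst (_∈ X) (sym (to-from (X⊆V a∈X))) a∈X)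

    ∣preimage∣ : X ⊆ V → ∣ preimage σ X ∣ ≡ ∣ X ∣
    ∣preimage∣ {X = X} X⊆V = ≤-antisym
      (injectiveOn⇒∣p∣≤∣q∣ to _ X (proj₂ ∘ ∈-select⁻ _) λ x∈ y∈ tx≡ty →
        trans (sym (from-to (proj₁ (∈-select⁻ _ x∈)))) (trans (cong from tx≡ty) (from-to (proj₁ (∈-select⁻ _ y∈)))))
      (injectiveOn⇒∣p∣≤∣q∣ from X _ (from-∈ X⊆V) λ x∈ y∈ fx≡fy →
        trans (sym (to-from (X⊆V x∈))) (trans (cong to fx≡fy) (to-from (X⊆V y∈))))

    InNbhd-preimage⁻ : InNbhd (preimage σ X) v → InNbhd X (to v)
    InNbhd-preimage⁻ (v∈V , v∉ , a , a∈ , e) =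
      to-∈V v∈V , (λ tv∈X → v∉ (∈-select⁺ _ (v∈V , tv∈X))) , to a , proj₂ (∈-select⁻ _ a∈) , to-edge e

    InNbhd-preimage⁺ : X ⊆ V → v ∈ V → InNbhd X (to v) → InNbhd (preimage σ X) v
    InNbhd-preimage⁺ X⊆V v∈V (_ , tv∉X , a , a∈X , e) =
      v∈V , tv∉X ∘ proj₂ ∘ ∈-select⁻ _ , from a , from-∈ X⊆V a∈X , subst (E (from a)) (from-to v∈V) (from-edge e)

    preimage-part : IsPart X → IsPart (preimage σ X)
    preimage-part {X = X} (X⊆V , w , w∈V , w∉X , w∉N) =
      proj₁ ∘ ∈-select⁻ _ , from w , from-∈V w∈V ,
      (λ fw∈ → w∉X (subst (_∈ X) (to-from w∈V) (proj₂ (∈-select⁻ _ fw∈)))) ,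
      λ fwN → w∉N (subst (InNbhd X) (to-from w∈V) (InNbhd-preimage⁻ fwN))

    preimage-NbhdSize : IsPart X → NbhdSize X k → NbhdSize (preimage σ X) k
    preimage-NbhdSize {X = X} (X⊆V , _) size = ∣N⁺∣≡⇒NbhdSize (begin
      ∣ N⁺ (preimage σ X) ∣   ≡⟨ cong ∣_∣ (⊆-antisym N⁺⊆ ⊆N⁺) ⟩
      ∣ preimage σ (N⁺ X) ∣   ≡⟨ ∣preimage∣ (proj₁ ∘ ∈-select⁻ _) ⟩
      ∣ N⁺ X ∣                ≡⟨ NbhdSize⇒∣N⁺∣≡ size ⟩
      _                       ∎)
      where
      open ≡-Reasoning
      N⁺⊆ : N⁺ (preimage σ X) ⊆ preimage σ (N⁺ X)
      N⁺⊆ v∈ = let vN = ∈-select⁻ _ v∈ in ∈-select⁺ _ (proj₁ vN , ∈-select⁺ _ (InNbhd-preimage⁻ vN))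
      ⊆N⁺ : preimage σ (N⁺ X) ⊆ N⁺ (preimage σ X)
      ⊆N⁺ v∈ = let v∈V , tv∈N = ∈-select⁻ _ v∈ in ∈-select⁺ _ (InNbhd-preimage⁺ X⊆V v∈V (∈-select⁻ _ tv∈N))

  preimage-atom : ∀ σ → IsAtom k X → IsAtom k (preimage σ X)
  preimage-atom {X = X} σ (partX , sizeX , minX) = preimage-part σ partX , preimage-NbhdSize σ partX sizeX ,
    λ C partC sizeC → begin
      ∣ preimage σ X ∣             ≡⟨ ∣preimage∣ σ (proj₁ partX) ⟩
      ∣ X ∣                        ≤⟨ minX _ (preimage-part (inverse σ) partC) (preimage-NbhdSize (inverse σ) partC sizeC) ⟩
      ∣ preimage (inverse σ) C ∣   ≡⟨ ∣preimage∣ (inverse σ) (proj₁ partC) ⟩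
      ∣ C ∣                        ∎
    where open ≤-Reasoning

  module _ {κ : ℕ} (connectivity : IsConnectivity κ) where

    κ≤∣N⁺∣ : IsPart A → Nonempty A → κ ≤ ∣ N⁺ A ∣
    κ≤∣N⁺∣ {A = A} (A⊆V , w , w∈V , w∉A , w∉N) (a , a∈A) =
      proj₂ connectivity (N⁺ A) (proj₁ ∘ ∈-select⁻ _) λ strong →
        w∉A (reach-avoiding-N⁺ (strong a w (A⊆V a∈A , a∉N⁺) (w∈V , w∉N ∘ ∈-select⁻ _)) a∈A)
      where
      a∉N⁺ : a ∉ N⁺ A
      a∉N⁺ a∈N = proj₁ (proj₂ (∈-select⁻ _ a∈N)) a∈A

    κ≤∣N⁻∣ : A ⊆ V → Nonempty A → (∃ λ w → w ∈ V × w ∉ A × ¬ InNbhd⁻ A w) → κ ≤ ∣ N⁻ A ∣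
    κ≤∣N⁻∣ {A = A} A⊆V (a , a∈A) (w , w∈V , w∉A , w∉N) =
      proj₂ connectivity (N⁻ A) (proj₁ ∘ ∈-select⁻ _) λ strong →
        w∉A (reach-avoiding-N⁻ w-kept (strong w a w-kept (A⊆V a∈A , a∉N⁻)) a∈A)
      where
      w-kept : Remaining (N⁻ A) w
      w-kept = w∈V , w∉N ∘ ∈-select⁻ _
      a∉N⁻ : a ∉ N⁻ A
      a∉N⁻ a∈N = proj₁ (proj₂ (∈-select⁻ _ a∈N)) a∈A

    atom-∩⇒⊆ : IsAtom κ A → IsAtom κ B → 2 * ∣ A ∣ ≤ order ∸ κ → Nonempty (A ∩ B) → A ⊆ B
    atom-∩⇒⊆ {A = A} {B = B} atomA@((A⊆V , _) , sizeA , minA) atomB@((_ , wB , wB-ext) , sizeB , _) small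
             A∩B≠∅@(c , c∈A∩B) with nonempty? (exterior A ∩ exterior B)
    ... | yes (w , w∈Q) =
      p∩q⊆q A B ∘ p⊆q∧∣q∣≤∣p∣⇒q⊆p (p∩q⊆p A B)
        (minA (A ∩ B) part (∣N⁺∣≡⇒NbhdSize (≤-antisym ∣N⁺∣≤κ (κ≤∣N⁺∣ part A∩B≠∅))))
      where
      Q : Subset n
      Q = exterior A ∩ exterior B
      part : IsPart (A ∩ B)
      part = A⊆V ∘ p∩q⊆p A B , w , exterior-∩ʳ (∈-select⁻ _ (proj₂ (x∈p∩q⁻ _ _ w∈Q)))
      c∈A : c ∈ A
      c∈A = proj₁ (x∈p∩q⁻ A B c∈A∩B)
      κ≤∣N⁻Q∣ : κ ≤ ∣ N⁻ Q ∣
      κ≤∣N⁻Q∣ = κ≤∣N⁻∣ (proj₁ ∘ ∈-select⁻ _ ∘ proj₁ ∘ x∈p∩q⁻ _ _) (w , w∈Q)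
        (c , A⊆V c∈A , (λ c∈Q → proj₁ (proj₂ (∈-select⁻ _ (proj₁ (x∈p∩q⁻ _ _ c∈Q)))) c∈A) ,
         λ cN → proj₁ (into-exterior-∩ cN) c∈A)
      ∣N⁺∣≤κ : ∣ N⁺ (A ∩ B) ∣ ≤ κ
      ∣N⁺∣≤κ = +-cancelʳ-≤ κ _ κ (begin
        ∣ N⁺ (A ∩ B) ∣ + κ              ≤⟨ +-monoʳ-≤ ∣ N⁺ (A ∩ B) ∣ κ≤∣N⁻Q∣ ⟩
        ∣ N⁺ (A ∩ B) ∣ + ∣ N⁻ Q ∣       ≤⟨ ∣N⁺∣-submodular A B ⟩
        ∣ N⁺ A ∣ + ∣ N⁺ B ∣             ≡⟨ cong₂ _+_ (NbhdSize⇒∣N⁺∣≡ sizeA) (NbhdSize⇒∣N⁺∣≡ sizeB) ⟩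
        κ + κ                           ∎)
        where open ≤-Reasoning
    ... | no disjoint = ⊥-elim (<-irrefl refl (begin-strict
      κ + ∣ A ∣                        ≤⟨ +-mono-≤ (κ≤∣N⁺∣ part A∩B≠∅) (small-atom≤exterior atomA atomB small) ⟩
      ∣ N⁺ (A ∩ B) ∣ + ∣ exterior B ∣  ≤⟨ ∣N⁺[A∩B]∣+∣exterior[B]∣≤∣N⁺[A]∣+∣A─B∣ A B disjoint ⟩
      ∣ N⁺ A ∣ + ∣ A ─ B ∣             <⟨ +-monoʳ-< ∣ N⁺ A ∣ (p∩q≢∅⇒∣p─q∣<∣p∣ A B A∩B≠∅) ⟩
      ∣ N⁺ A ∣ + ∣ A ∣                 ≡⟨ cong (_+ ∣ A ∣) (NbhdSize⇒∣N⁺∣≡ sizeA) ⟩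
      κ + ∣ A ∣                        ∎))
      where
      open ≤-Reasoning
      part : IsPart (A ∩ B)
      part = A⊆V ∘ p∩q⊆p A B , wB , exterior-∩ʳ wB-ext

    atom-invariant : (σ : Automorphism) → IsAtom κ A → 2 * ∣ A ∣ ≤ order ∸ κ
      → a ∈ A → Automorphism.to σ a ∈ A
      → ∀ {v} → v ∈ V → (v ∈ A → Automorphism.to σ v ∈ A) × (Automorphism.to σ v ∈ A → v ∈ A)
    atom-invariant {A = A} {a = a} σ atomA@((A⊆V , _) , _) small a∈A σa∈A v∈V =
      (λ v∈A → proj₂ (∈-select⁻ _ (A⊆σ⁻¹A v∈A))) , (λ σv∈A → σ⁻¹A⊆A (∈-select⁺ _ (v∈V , σv∈A)))
      where
      σ⁻¹A : Subset n
      σ⁻¹A = preimage σ A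
      a∈σ⁻¹A : a ∈ σ⁻¹A
      a∈σ⁻¹A = ∈-select⁺ _ (A⊆V a∈A , σa∈A)
      A⊆σ⁻¹A : A ⊆ σ⁻¹A
      A⊆σ⁻¹A = atom-∩⇒⊆ atomA (preimage-atom σ atomA) small (a , x∈p∩q⁺ (a∈A , a∈σ⁻¹A))
      σ⁻¹A⊆A : σ⁻¹A ⊆ A
      σ⁻¹A⊆A = atom-∩⇒⊆ (preimage-atom σ atomA) atomA
        (subst (λ m → 2 * m ≤ order ∸ κ) (sym (∣preimage∣ σ A⊆V)) small)
        (a , x∈p∩q⁺ (a∈σ⁻¹A , a∈A))

    atom-reach : IsAtom κ A → a ∈ A → v ∈ A → Reach (_∈ A) a v
    atom-reach {A = A} {a = a} ((A⊆V , w , w-ext) , sizeA , minA) a∈A v∈A with reachable-within A a∈A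
    ... | R , a∈R , closed , reached = proj₂ (reached (p⊆q∧∣q∣≤∣p∣⇒q⊆p R⊆A (minA R partR sizeR) v∈A))
      where
      R⊆A : R ⊆ A
      R⊆A = proj₁ ∘ reached
      N⁺R⊆N⁺A : ∀ {u} → InNbhd R u → InNbhd A u
      N⁺R⊆N⁺A (u∈V , u∉R , r , r∈R , e) = u∈V , (λ u∈A → u∉R (closed r∈R e u∈A)) , r , R⊆A r∈R , e
      partR : IsPart R
      partR = A⊆V ∘ R⊆A , w , proj₁ w-ext , proj₁ (proj₂ w-ext) ∘ R⊆A , proj₂ (proj₂ w-ext) ∘ N⁺R⊆N⁺A
      sizeR : NbhdSize R κ
      sizeR = ∣N⁺∣≡⇒NbhdSize (≤-antisym
        (≤-trans (p⊆q⇒∣p∣≤∣q∣ λ u∈ → ∈-select⁺ (InNbhd? A) (N⁺R⊆N⁺A (∈-select⁻ (InNbhd? R) u∈)))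
                 (≤-reflexive (NbhdSize⇒∣N⁺∣≡ sizeA)))
        (κ≤∣N⁺∣ partR (a , a∈R)))

module LeftTranslation (G : FiniteGroup) (H : Subset (FiniteGroup.N G)) (H≤G : CosetDigraph.IsSubgroup G H)
                       (S T : Subset (FiniteGroup.N G)) (transversal : CosetDigraph.IsTransversal G H T) where

  open FiniteGroup G
  open CosetDigraph G

  open IsGroup isGroup using (assoc; identityˡ; identityʳ; inverseˡ; inverseʳ)

  group : Group 0ℓ 0ℓ
  group = record { Carrier = Fin N ; _≈_ = _≡_ ; _∙_ = _∙_ ; ε = ε ; _⁻¹ = _⁻¹ ; isGroup = isGroup }

  open import Algebra.Properties.Group group using (x≈z//y; y≈x\\z; \\-leftDividesˡ)

  private variable
    g g′ h s t x x′ y y′ z : Fin N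

  ε∈H : ε ∈ H
  ε∈H = proj₁ H≤G

  ∙-∈H : x ∈ H → y ∈ H → x ∙ y ∈ H
  ∙-∈H = proj₁ (proj₂ H≤G) _ _

  ⁻¹-∈H : x ∈ H → x ⁻¹ ∈ H
  ⁻¹-∈H = proj₂ (proj₂ H≤G) _

  coset-refl : ∀ x → InCoset H x x
  coset-refl x = ε , ε∈H , sym (identityʳ x)

  coset-sym : InCoset H x y → InCoset H y x
  coset-sym {x} {y} (h , h∈H , y≡xh) = h ⁻¹ , ⁻¹-∈H h∈H , x≈z//y x h y (sym y≡xh)

  coset-trans : InCoset H x y → InCoset H y z → InCoset H x z
  coset-trans {x} (h , h∈H , y≡xh) (k , k∈H , z≡yk) =
    h ∙ k , ∙-∈H h∈H k∈H , trans z≡yk (trans (cong (_∙ k) y≡xh) (assoc x h k))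

  coset-left : ∀ g → InCoset H x y → InCoset H (g ∙ x) (g ∙ y)
  coset-left {x} g (h , h∈H , y≡xh) = h , h∈H , trans (cong (g ∙_) y≡xh) (sym (assoc g x h))

  rep : Fin N → Fin N
  rep g = proj₁ (proj₁ transversal g)

  rep∈T : ∀ g → rep g ∈ T
  rep∈T g = proj₁ (proj₂ (proj₁ transversal g))

  rep-coset : ∀ g → InCoset H (rep g) g
  rep-coset g = proj₂ (proj₂ (proj₁ transversal g))

  rep-unique : t ∈ T → InCoset H t g → rep g ≡ t
  rep-unique t∈T t~g = sym (proj₂ transversal _ _ t∈T (rep∈T _) (coset-trans t~g (coset-sym (rep-coset _))))

  rep-cong : InCoset H x y → rep x ≡ rep y
  rep-cong x~y = sym (rep-unique (rep∈T _) (coset-trans (rep-coset _) x~y))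

  edge-left : ∀ g → EdgeBy H s x y → EdgeBy H s (g ∙ x) (g ∙ y)
  edge-left {s} {x} {y} g (h , k , h∈H , k∈H , xhs≡yk) = h , k , h∈H , k∈H , (begin
    g ∙ x ∙ h ∙ s     ≡⟨ cong (_∙ s) (assoc g x h) ⟩
    g ∙ (x ∙ h) ∙ s   ≡⟨ assoc g (x ∙ h) s ⟩
    g ∙ (x ∙ h ∙ s)   ≡⟨ cong (g ∙_) xhs≡yk ⟩
    g ∙ (y ∙ k)       ≡⟨ assoc g y k ⟨
    g ∙ y ∙ k         ∎)
    where open ≡-Reasoning

  edge-cong : EdgeBy H s x y → InCoset H x x′ → InCoset H y y′ → EdgeBy H s x′ y′
  edge-cong {s} {x} {y} {x′} {y′} (h , k , h∈H , k∈H , xhs≡yk) x~x′ y~y′ with coset-sym x~x′ | coset-sym y~y′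
  ... | h₁ , h₁∈H , x≡x′h₁ | h₂ , h₂∈H , y≡y′h₂ = h₁ ∙ h , h₂ ∙ k , ∙-∈H h₁∈H h∈H , ∙-∈H h₂∈H k∈H , (begin
    x′ ∙ (h₁ ∙ h) ∙ s   ≡⟨ cong (_∙ s) (assoc x′ h₁ h) ⟨
    x′ ∙ h₁ ∙ h ∙ s     ≡⟨ cong (λ z → z ∙ h ∙ s) x≡x′h₁ ⟨
    x ∙ h ∙ s           ≡⟨ xhs≡yk ⟩
    y ∙ k               ≡⟨ cong (_∙ k) y≡y′h₂ ⟩
    y′ ∙ h₂ ∙ k         ≡⟨ assoc y′ h₂ k ⟩
    y′ ∙ (h₂ ∙ k)       ∎)
    where open ≡-Reasoning

  Edge? : ∀ x y → Dec (Edge H S x y)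
  Edge? x y = any? λ s → (s ∈? S) ×-dec any? λ h → any? λ k → (h ∈? H) ×-dec (k ∈? H) ×-dec (x ∙ h ∙ s ≟ y ∙ k)

  open Digraph T (Edge H S)
  open Atoms T (Edge H S) Edge?

  -- G acts on G/H by left multiplication; t ∈ T stands for the coset tH.
  translate : Fin N → Fin N → Fin N
  translate g t = rep (g ∙ t)

  translate-rep : ∀ g x → translate g (rep x) ≡ rep (g ∙ x)
  translate-rep g x = rep-cong (coset-left g (rep-coset x))

  translate-inverse : g ∙ g′ ≡ ε → t ∈ T → translate g (translate g′ t) ≡ t
  translate-inverse {g} {g′} {t} gg′≡ε t∈T = begin
    translate g (rep (g′ ∙ t))   ≡⟨ translate-rep g (g′ ∙ t) ⟩
    rep (g ∙ (g′ ∙ t))           ≡⟨ cong rep (assoc g g′ t) ⟨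
    rep (g ∙ g′ ∙ t)             ≡⟨ cong (λ x → rep (x ∙ t)) gg′≡ε ⟩
    rep (ε ∙ t)                  ≡⟨ cong rep (identityˡ t) ⟩
    rep t                        ≡⟨ rep-unique t∈T (coset-refl t) ⟩
    t                            ∎
    where open ≡-Reasoning

  translate-edge : ∀ g → Edge H S x y → Edge H S (translate g x) (translate g y)
  translate-edge g (s , s∈S , x→y) =
    s , s∈S , edge-cong (edge-left g x→y) (coset-sym (rep-coset _)) (coset-sym (rep-coset _))

  translation : Fin N → Automorphism
  translation g = record
    { to = translate g ; from = translate (g ⁻¹)
    ; to-∈V = λ _ → rep∈T _ ; from-∈V = λ _ → rep∈T _
    ; from-to = translate-inverse (inverseˡ g) ; to-from = translate-inverse (inverseʳ g)
    ; to-edge = translate-edge g ; from-edge = translate-edge (g ⁻¹) }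

  Union⇒rep∈ : {A : Subset N} → A ⊆ T → Union H A g → rep g ∈ A
  Union⇒rep∈ {A = A} A⊆T (a , a∈A , a~g) = subst (_∈ A) (sym (rep-unique (A⊆T a∈A) a~g)) a∈A

  rep∈⇒Union : {A : Subset N} → rep g ∈ A → Union H A g
  rep∈⇒Union r∈A = rep _ , r∈A , rep-coset _

  module AtomContainingH {κ : ℕ} (connectivity : IsConnectivity κ)
                         {A₀ : Subset N} (atom₀ : IsAtom κ A₀) (small₀ : 2 * ∣ A₀ ∣ ≤ order ∸ κ)
                         {t₀ : Fin N} (t₀∈T : t₀ ∈ T) (t₀∈H : t₀ ∈ H) (t₀∈A₀ : t₀ ∈ A₀) where

    S₀ : Fin N → Set
    S₀ x = x ∈ H ⊎ (x ∈ S × Union H A₀ x)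

    A₀⊆T : A₀ ⊆ T
    A₀⊆T = proj₁ (proj₁ atom₀)

    rep-H : h ∈ H → rep h ≡ t₀
    rep-H {h} h∈H = rep-unique t₀∈T (t₀ ⁻¹ ∙ h , ∙-∈H (⁻¹-∈H t₀∈H) h∈H , sym (\\-leftDividesˡ t₀ h))

    translation-fixes-A₀ : Union H A₀ g → t ∈ T → (t ∈ A₀ → translate g t ∈ A₀) × (translate g t ∈ A₀ → t ∈ A₀)
    translation-fixes-A₀ {g} g∈⋃A₀ =
      atom-invariant connectivity (translation g) atom₀ small₀ t₀∈A₀
        -- translate g t₀ = rep g because t₀ ∈ H
        (subst (_∈ A₀) (rep-cong (t₀ , t₀∈H , refl)) (Union⇒rep∈ A₀⊆T g∈⋃A₀))

    Union-H : h ∈ H → Union H A₀ h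
    Union-H h∈H = rep∈⇒Union (subst (_∈ A₀) (sym (rep-H h∈H)) t₀∈A₀)

    Union-∙ : Union H A₀ g → Union H A₀ g′ → Union H A₀ (g ∙ g′)
    Union-∙ {g} {g′} g∈⋃A₀ g′∈⋃A₀ = rep∈⇒Union (subst (_∈ A₀) (translate-rep g g′)
      (proj₁ (translation-fixes-A₀ g∈⋃A₀ (rep∈T g′)) (Union⇒rep∈ A₀⊆T g′∈⋃A₀)))

    Union-⁻¹ : Union H A₀ g → Union H A₀ (g ⁻¹)
    Union-⁻¹ {g} g∈⋃A₀ = rep∈⇒Union (proj₂ (translation-fixes-A₀ g∈⋃A₀ (rep∈T (g ⁻¹)))
      (subst (_∈ A₀) (sym (trans (translate-rep g (g ⁻¹)) (trans (cong rep (inverseʳ g)) (rep-H ε∈H)))) t₀∈A₀))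

    Gen⇒Union : Gen S₀ g → Union H A₀ g
    Gen⇒Union (gen (inj₁ h∈H))        = Union-H h∈H
    Gen⇒Union (gen (inj₂ (_ , s∈⋃A₀))) = s∈⋃A₀
    Gen⇒Union one                      = Union-H ε∈H
    Gen⇒Union (mul x y)                = Union-∙ (Gen⇒Union x) (Gen⇒Union y)
    Gen⇒Union (inv x)                  = Union-⁻¹ (Gen⇒Union x)

    label∈Union : ∀ {u v} → u ∈ A₀ → v ∈ A₀ → EdgeBy H s u v → Union H A₀ s
    label∈Union {s} {u} {v} u∈A₀ v∈A₀ (h , k , h∈H , k∈H , uhs≡vk) =
      subst (Union H A₀) (sym (y≈x\\z (u ∙ h) s (v ∙ k) uhs≡vk))
        (Union-∙ (Union-⁻¹ (Union-∙ (u , u∈A₀ , coset-refl u) (Union-H h∈H))) (Union-∙ (v , v∈A₀ , coset-refl v) (Union-H k∈H)))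

    walk⇒Gen : ∀ {u v} → Reach (_∈ A₀) u v → u ∈ A₀ → Gen S₀ u → Gen S₀ v
    walk⇒Gen here _ u∈⟨S₀⟩ = u∈⟨S₀⟩
    walk⇒Gen {u} (step {w = w} (s , s∈S , u→w@(h , k , h∈H , k∈H , uhs≡wk)) w∈A₀ walk) u∈A₀ u∈⟨S₀⟩ =
      walk⇒Gen walk w∈A₀ (subst (Gen S₀) (sym (x≈z//y w k (u ∙ h ∙ s) (sym uhs≡wk)))
        (mul (mul (mul u∈⟨S₀⟩ (gen (inj₁ h∈H))) (gen (inj₂ (s∈S , label∈Union u∈A₀ w∈A₀ u→w)))) (inv (gen (inj₁ k∈H)))))

    Union⇒Gen : Union H A₀ g → Gen S₀ g
    Union⇒Gen (a , a∈A₀ , h , h∈H , g≡ah) = subst (Gen S₀) (sym g≡ah)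
      (mul (walk⇒Gen (atom-reach connectivity atom₀ t₀∈A₀ a∈A₀) t₀∈A₀ (gen (inj₁ t₀∈H))) (gen (inj₁ h∈H)))

open FiniteGroup using (N)
open CosetDigraph using (IsSubgroup; Gen; InDoubleCoset; IsTransversal; EdgeBy; Edge; Union)
open Digraph using (order; IsComplete; IsConnectivity; IsAtom)

lemma10 : (G : FiniteGroup) (H S : Subset (N G))
    → IsSubgroup G H
    → (∀ s → s ∈ S → s ∉ H)
    → (∀ s s' → s ∈ S → s' ∈ S → InDoubleCoset G H s s' → s ≡ s')
    → (∀ g → Gen G (λ x → x ∈ H ⊎ x ∈ S) g)
    → (T : Subset (N G)) → IsTransversal G H T
    → (κ : ℕ) → IsConnectivity T (Edge G H S) κ
    → ¬ IsComplete T (Edge G H S)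
    → (∃ λ A → IsAtom T (Edge G H S) κ A × 2 * ∣ A ∣ ≤ order T (Edge G H S) ∸ κ)
    → (A₀ : Subset (N G)) → IsAtom T (Edge G H S) κ A₀
    → (t₀ : Fin (N G)) → t₀ ∈ T → t₀ ∈ H → t₀ ∈ A₀
    → ((∀ g → Union G H A₀ g
          → Gen G (λ x → x ∈ H ⊎ (x ∈ S × Union G H A₀ x)) g)
       × (∀ g → Gen G (λ x → x ∈ H ⊎ (x ∈ S × Union G H A₀ x)) g
          → Union G H A₀ g))
      × (∀ u v → u ∈ A₀ → v ∈ A₀
          → (Edge G H S u v
              → ∃ λ s → (s ∈ S × Union G H A₀ s) × EdgeBy G H s u v)
            × ((∃ λ s → (s ∈ S × Union G H A₀ s) × EdgeBy G H s u v)
              → Edge G H S u v))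
lemma10 G H S H≤G _ _ _ T transversal κ connectivity _ (_ , atom₁ , small₁) A₀ atom₀ t₀ t₀∈T t₀∈H t₀∈A₀ =
  ((λ _ → Union⇒Gen) , (λ _ → Gen⇒Union)) ,
  λ u v u∈A₀ v∈A₀ → (λ (s , s∈S , u→v) → s , (s∈S , label∈Union u∈A₀ v∈A₀ u→v) , u→v)
                  , (λ (s , (s∈S , _) , u→v) → s , s∈S , u→v)
  where
  open LeftTranslation G H H≤G S T transversal
  open Atoms T (Edge G H S) Edge? using (atoms-same-size)

  small₀ : 2 * ∣ A₀ ∣ ≤ order T (Edge G H S) ∸ κ
  small₀ = subst (λ m → 2 * m ≤ order T (Edge G H S) ∸ κ) (atoms-same-size atom₁ atom₀) small₁

  open AtomContainingH connectivity atom₀ small₀ t₀∈T t₀∈H t₀∈A₀
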